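{- Define the stable set formulation $R^{(A)}$ by $R^{(A)}(G) = \{x \in R_{\mathrm{edge}}(G) : \sum_{v \in C} x_v \le 1.4 \text{ for each 3-clique } C \text{ of } G\}$ for every finite simple graph $G$. Then $R^{(A)}$ satisfies Conditions (B) and (C), violates Condition (A), and $R^{(A)}(G)$ has the persistency property for every finite simple graph $G$.
   Context: $\mathcal{G}$ is the set of finite undirected simple graphs. For $G \in \mathcal{G}$, $P_{\mathrm{stab}}(G)$ is the convex hull of characteristic vectors of stable sets of $G$ and $R_{\mathrm{edge}}(G) = \{x \in [0,1]^{V(G)} : x_v + x_w \le 1 \text{ for each edge } \{v,w\} \in E(G)\}$. A stable set formulation is a map $R$ assigning to every $G \in \mathcal{G}$ a polytope $R(G) \subseteq \mathbb{R}^{V(G)}$ with $R(G) \cap \mathbb{Z}^{V(G)} = P_{\mathrm{stab}}(G) \cap \mathbb{Z}^{V(G)}$. For $U \subseteq V(G)$, $G[U]$ is the induced subgraph; an inequality with support $U$ is regarded as an inequality on $\mathbb{R}^U$ for polytopes of $G[U]$. Condition (A): for each $G$, each inequality with support $U$ that is facet-defining for $R(G)$ is also facet-defining for $P_{\mathrm{stab}}(G[U])$. Condition (B): for each $G$, each inequality with support $U$ that is facet-defining for $R(G)$ is valid for $R(G[U])$. The 1-sum $G_1 \oplus^{v_1}_{v_2} G_2$ is the disjoint union of $G_1, G_2$ with $v_1 \in V(G_1)$ and $v_2 \in V(G_2)$ identified; for polytopes $P \subseteq \mathbb{R}^m$, $Q \subseteq \mathbb{R}^n$, $P \oplus^i_j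 Q$ is the projection of $\mathrm{conv}(\{(x,y) \in P \times Q : x_i = y_j\})$ onto all variables except $y_j$. Condition (C): $R(G_1 \oplus^{v_1}_{v_2} G_2) \subseteq R(G_1) \oplus^{v_1}_{v_2} R(G_2)$ for all $G_1, G_2, v_1, v_2$. A polytope $P \subseteq [0,1]^n$ has the persistency property if for every $c \in \mathbb{R}^n$ and every $c$-maximal point $x \in P$ there is a $c$-maximal $y \in P \cap \{0,1\}^n$ (maximal among integer points of $P$) with $y_i = x_i$ whenever $x_i \in \{0,1\}$.
   Formalization: Points, cost vectors c and inequality coefficients are taken over ℚ rather than ℝ, in Conditions (A), (B) and (C), the 1-sum of polytopes and the persistency property. -}

module Defs where

open import Data.Nat using (ℕ; zero; suc)
open import Data.Bool using (Bool; true; false; if_then_else_; _∨_; _∧_; not)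
open import Data.Fin using (Fin; zero; suc; splitAt; punchIn; _↑ˡ_; _↑ʳ_)
open import Data.Fin.Properties using () renaming (_≟_ to _≟F_)
open import Data.Maybe using (Maybe; just; nothing)
open import Data.Sum using (_⊎_; inj₁; inj₂)
open import Data.Product using (Σ; ∃; _×_; _,_)
open import Data.List using (List; map; foldr)
open import Data.List.Relation.Unary.All using (All)
open import Data.Integer using (+_)
open import Data.Rational using (ℚ; 0ℚ; 1ℚ; _≤_; _+_; _*_; _/_)
open import Data.Rational.Properties using (_≟_)
open import Relation.Nullary using (¬_)
open import Relation.Nullary.Decidable using (⌊_⌋)
open import Relation.Binary.PropositionalEquality using (_≡_; _≢_)

Pt : ℕ → Set
Pt n = Fin n → ℚ

PSet : ℕ → Set₁
PSet n = Pt n → Set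

sumF : ∀ {n} → (Fin n → ℚ) → ℚ
sumF {zero}  f = 0ℚ
sumF {suc n} f = f zero + sumF (λ i → f (suc i))

_·_ : ∀ {n} → Pt n → Pt n → ℚ
a · x = sumF (λ i → a i * x i)

sumL : List ℚ → ℚ
sumL = foldr _+_ 0ℚ

Conv : ∀ {n} → PSet n → PSet n
Conv {n} S x =
  Σ (List (ℚ × Pt n)) λ L →
    All (λ { (l , p) → (0ℚ ≤ l) × S p }) L
    × (sumL (map (λ { (l , p) → l }) L) ≡ 1ℚ)
    × (∀ v → x v ≡ sumL (map (λ { (l , p) → l * p v }) L))

AffIndep : ∀ {n k} → (Fin k → Pt n) → Set
AffIndep {n} {k} p =
  (λc : Fin k → ℚ) → sumF λc ≡ 0ℚ →
  (∀ v → sumF (λ i → λc i * p i v) ≡ 0ℚ) → ∀ i → λc i ≡ 0ℚ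

-- AffRank S r : the maximum number of affinely independent points of S is r
-- (so dim S = r - 1, with the empty set having rank 0, i.e. dimension -1)
AffRank : ∀ {n} → PSet n → ℕ → Set
AffRank {n} S r =
  (Σ (Fin r → Pt n) λ p → (∀ i → S (p i)) × AffIndep p)
  × ((p : Fin (suc r) → Pt n) → (∀ i → S (p i)) → ¬ AffIndep p)

Valid : ∀ {n} → Pt n → ℚ → PSet n → Set
Valid a b S = ∀ x → S x → a · x ≤ b

FacetDefining : ∀ {n} → Pt n → ℚ → PSet n → Set
FacetDefining a b S =
  Valid a b S ×
  Σ ℕ λ r → AffRank S (suc r) × AffRank (λ x → S x × (a · x ≡ b)) r

-- Graphs.  A finite simple graph on vertex set Fin n is given by a
-- Boolean matrix E; vertices v, w are adjacent iff v ≢ w and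
-- (E v w or E w v).  Every finite simple graph arises this way.

record Graph : Set where
  constructor mkGraph
  field
    n : ℕ
    E : Fin n → Fin n → Bool
open Graph public

Adj : (G : Graph) → Fin (n G) → Fin (n G) → Set
Adj G v w = (v ≢ w) × ((E G v w ≡ true) ⊎ (E G w v ≡ true))

StableChar : (G : Graph) → PSet (n G)
StableChar G x =
  (∀ v → (x v ≡ 0ℚ) ⊎ (x v ≡ 1ℚ)) ×
  (∀ v w → Adj G v w → ¬ ((x v ≡ 1ℚ) × (x w ≡ 1ℚ)))

Pstab : (G : Graph) → PSet (n G)
Pstab G = Conv (StableChar G)

Redge : (G : Graph) → PSet (n G)
Redge G x =
  (∀ v → (0ℚ ≤ x v) × (x v ≤ 1ℚ)) ×
  (∀ v w → Adj G v w → x v + x w ≤ 1ℚ)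

Formulation : Set₁
Formulation = (G : Graph) → PSet (n G)

RA : Formulation
RA G x =
  Redge G x ×
  (∀ u v w → Adj G u v → Adj G v w → Adj G u w →
     x u + x v + x w ≤ + 7 / 5)

-- Induced subgraphs on a Boolean subset, with vertices of G[U]
-- enumerated in increasing order.

count : ∀ {n} → (Fin n → Bool) → ℕ
count {zero}  s = zero
count {suc n} s = if s zero then suc (count (λ i → s (suc i))) else count (λ i → s (suc i))

emb : ∀ {n} (s : Fin n → Bool) → Fin (count s) → Fin n
emb {suc n} s i with s zero
emb {suc n} s zero    | true  = zero
emb {suc n} s (suc j) | true  = suc (emb (λ i → s (suc i)) j)
emb {suc n} s i       | false = suc (emb (λ i → s (suc i)) i)

Induced : (G : Graph) → (Fin (n G) → Bool) → Graph
Induced G s = mkGraph (count s) (λ i j → E G (emb s i) (emb s j))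

supp : ∀ {n} → Pt n → Fin n → Bool
supp a v = not ⌊ a v ≟ 0ℚ ⌋

CondA : Formulation → Set
CondA R = ∀ (G : Graph) (a : Pt (n G)) (b : ℚ) → FacetDefining a b (R G) →
  FacetDefining (λ i → a (emb (supp a) i)) b (Pstab (Induced G (supp a)))

CondB : Formulation → Set
CondB R = ∀ (G : Graph) (a : Pt (n G)) (b : ℚ) → FacetDefining a b (R G) →
  Valid (λ i → a (emb (supp a) i)) b (R (Induced G (supp a)))

-- For G1 on Fin n1 and G2 on Fin (suc m), the 1-sum identifying
-- v1 and v2 has vertex set Fin (n1 + m): the first n1 vertices are those of
-- G1 (v1 being the identified vertex), and n1 ↑ʳ l is vertex punchIn v2 l of G2.

part1 : ∀ {n1 m} → Fin (n1 Data.Nat.+ m) → Maybe (Fin n1)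
part1 {n1} z with splitAt n1 z
... | inj₁ i = just i
... | inj₂ _ = nothing

part2 : ∀ {n1 m} → Fin n1 → Fin (suc m) → Fin (n1 Data.Nat.+ m) → Maybe (Fin (suc m))
part2 {n1} v1 v2 z with splitAt n1 z
... | inj₁ i = if ⌊ i ≟F v1 ⌋ then just v2 else nothing
... | inj₂ l = just (punchIn v2 l)

edgeIn : ∀ {k} → (Fin k → Fin k → Bool) → Maybe (Fin k) → Maybe (Fin k) → Bool
edgeIn e (just i) (just j) = e i j
edgeIn e _ _ = false

OneSumG : (G1 : Graph) {m : ℕ} (E2 : Fin (suc m) → Fin (suc m) → Bool) →
          Fin (n G1) → Fin (suc m) → Graph
OneSumG G1 {m} E2 v1 v2 =
  mkGraph (n G1 Data.Nat.+ m)
    (λ z w → edgeIn (E G1) (part1 z) (part1 w)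
           ∨ edgeIn E2 (part2 v1 v2 z) (part2 v1 v2 w))

-- P ⊕^i_j Q: projection of conv{(x,y) ∈ P × Q : x_i = y_j} forgetting y_j.
-- Pairs (x,y) are encoded as points w of ℚ^(n1 + suc m).
OneSumP : ∀ {n1 m} → PSet n1 → PSet (suc m) → Fin n1 → Fin (suc m) →
          PSet (n1 Data.Nat.+ m)
OneSumP {n1} {m} P Q i j z =
  Σ (Pt (n1 Data.Nat.+ suc m)) λ w →
    Conv (λ w' → P (λ k → w' (k ↑ˡ suc m)) × Q (λ l → w' (n1 ↑ʳ l))
                 × (w' (i ↑ˡ suc m) ≡ w' (n1 ↑ʳ j))) w
    × (∀ k → z (k ↑ˡ m) ≡ w (k ↑ˡ suc m))
    × (∀ l → z (n1 ↑ʳ l) ≡ w (n1 ↑ʳ punchIn j l))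

CondC : Formulation → Set
CondC R = ∀ (G1 : Graph) {m : ℕ} (E2 : Fin (suc m) → Fin (suc m) → Bool)
            (v1 : Fin (n G1)) (v2 : Fin (suc m)) (z : Pt (n G1 Data.Nat.+ m)) →
  R (OneSumG G1 E2 v1 v2) z →
  OneSumP (R G1) (R (mkGraph (suc m) E2)) v1 v2 z

Binary : ∀ {n} → Pt n → Set
Binary x = ∀ v → (x v ≡ 0ℚ) ⊎ (x v ≡ 1ℚ)

Persistent : ∀ {n} → PSet n → Set
Persistent {n} P =
  ∀ (c x : Pt n) → P x → (∀ x' → P x' → c · x' ≤ c · x) →
  Σ (Pt n) λ y → P y × Binary y
    × (∀ y' → P y' → Binary y' → c · y' ≤ c · y)
    × (∀ i → (x i ≡ 0ℚ → y i ≡ 0ℚ) × (x i ≡ 1ℚ → y i ≡ 1ℚ))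

-- Every constraint of R^(A) lives on an edge or a triangle. Hence extending a point of
-- R^(A)(G[U]) by zeros gives a point of R^(A)(G), which yields (B); and since every edge and
-- triangle of a 1-sum lies in one of its sides, a point of R^(A)(G₁ ⊕ G₂) restricts to points of
-- R^(A)(G₁) and R^(A)(G₂) agreeing on the identified vertex, which yields (C).
--
-- (A) fails for the triangle K₃: x(K₃) ≤ 7/5 is a facet of R^(A)(K₃), its face containing the
-- affinely independent points (3/5, 2/5, 2/5), (2/5, 3/5, 2/5), (2/5, 2/5, 3/5), while a stable
-- set of K₃ has at most one vertex, so this inequality defines the empty face of P_stab(K₃).
--
-- Persistency: let x maximise c over R^(A)(G), let s be a best stable set and let y keep the
-- integral coordinates of x and follow s elsewhere; y is stable since x_v = 1 forces x_w = 0 on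
-- the neighbours of v. For small ε > 0 the point x + ε (χ s - χ y) still lies in R^(A)(G): it
-- only raises coordinates with x_v = 0, to ε ≤ 2/5 and only on s, and lowers coordinates with
-- x_v = 1. Optimality of x then gives c·s ≤ c·y, so y is an optimal stable set agreeing with x
-- wherever x is integral.

module Submission where

open import Algebra.Bundles using (CommutativeMonoid; CommutativeRing)
import Algebra.Properties.CommutativeSemigroup
open import Data.Bool using (Bool; true; false)
open import Data.Bool.Properties using (∨-zeroʳ) renaming (_≟_ to _≟B_)
open import Data.Empty using (⊥-elim)
open import Data.Fin using (Fin; zero; suc; punchIn; punchOut; _↑ˡ_; _↑ʳ_)
open import Data.Fin.Properties using (any?; all?; ↑ˡ-injective; splitAt-↑ˡ; splitAt-↑ʳ; punchInᵢ≢i; punchOut-cong; punchOut-punchIn; punchIn-punchOut) renaming (_≟_ to _≟F_)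
open import Data.List using (List; []; _∷_; map)
open import Data.List.Relation.Unary.All as All using (All)
open import Data.Maybe using (just)
open import Data.Maybe.Properties using (just-injective)
open import Data.Nat using (ℕ; zero; suc)
open import Data.Product using (∃; _×_; _,_; proj₁; proj₂)
open import Data.Sum using (_⊎_; inj₁; inj₂)
import Data.Integer as ℤ
open import Data.Rational using (ℚ; _/_; 0ℚ; 1ℚ; _≤_; _<_; _⊓_; _+_; _*_; _-_; -_; 1/_; NonZero; ≢-nonZero; nonNegative; positive)
open import Data.Rational.Properties
open import Data.Rational.Solver using (module +-*-Solver)
open import Data.Vec using (Vec; lookup; tabulate; replicate) renaming ([] to []ᵛ; _∷_ to _∷ᵛ_)
open import Data.Vec.Properties using (lookup∘tabulate; lookup-replicate)
open import Data.Vec.Functional using (insertAt; _++_) renaming (_∷_ to _◂_)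
open import Data.Vec.Functional.Properties using (insertAt-lookup; insertAt-punchIn; lookup-++ˡ; lookup-++ʳ)
open import Function using (_∘_)
open import Relation.Binary.PropositionalEquality
open import Relation.Nullary using (¬_; Dec; yes; no)
open import Relation.Unary using (Decidable)
open import Relation.Nullary.Decidable using (True; toWitness; toWitnessFalse; isYes; decidable-stable; ¬?; _×-dec_; _⊎-dec_; _→-dec_)
open import Algebra.Properties.Semiring.Sum (CommutativeRing.semiring +-*-commutativeRing)
  using (sum; sum-cong-≗; sum-replicate-zero; ∑-distrib-+; ∑-comm; sum-remove; *-distribˡ-sum)

open import Defs

2/5 7/5 : ℚ
2/5 = ℤ.+ 2 / 5
7/5 = ℤ.+ 7 / 5

decide-≤ : ∀ {p q} → {True (p ≤? q)} → p ≤ q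
decide-≤ {p} {q} {p≤q} = toWitness p≤q

decide-< : ∀ {p q} → {True (p <? q)} → p < q
decide-< {p} {q} {p<q} = toWitness p<q

0≢1 : 0ℚ ≢ 1ℚ
0≢1 ()

≤1⇒≤7/5 : ∀ {p} → p ≤ 1ℚ → p ≤ 7/5
≤1⇒≤7/5 p≤1 = ≤-trans p≤1 decide-≤

+-zero₁ : ∀ {a b c} → a ≡ 0ℚ → a + b + c ≡ b + c
+-zero₁ {b = b} refl = cong (_+ _) (+-identityˡ b)

+-zero₂ : ∀ a {b c} → b ≡ 0ℚ → a + b + c ≡ a + c
+-zero₂ a refl = cong (_+ _) (+-identityʳ a)

+-zero₃ : ∀ a b {c} → c ≡ 0ℚ → a + b + c ≡ a + b
+-zero₃ a b refl = +-identityʳ (a + b)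

+-cancelˡ-≤ : ∀ r {p q} → r + p ≤ r + q → p ≤ q
+-cancelˡ-≤ r {p} {q} r+p≤r+q = subst₂ _≤_ (cancel p) (cancel q) (+-monoʳ-≤ (- r) r+p≤r+q)
  where
  cancel : ∀ t → - r + (r + t) ≡ t
  cancel t = trans (sym (+-assoc (- r) r t)) (trans (cong (_+ t) (+-inverseˡ r)) (+-identityˡ t))

module *-CS = Algebra.Properties.CommutativeSemigroup (CommutativeMonoid.commutativeSemigroup *-1-commutativeMonoid)
module +-CS = Algebra.Properties.CommutativeSemigroup (CommutativeMonoid.commutativeSemigroup +-0-commutativeMonoid)

open +-*-Solver using (solve; _:+_; _:*_; _:-_; :-_; _:=_; con)

sumF≡sum : ∀ {n} (f : Fin n → ℚ) → sumF f ≡ sum f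
sumF≡sum {zero}  f = refl
sumF≡sum {suc n} f = cong (f zero +_) (sumF≡sum (f ∘ suc))

sumF-cong : ∀ {n} {f g : Fin n → ℚ} → (∀ i → f i ≡ g i) → sumF f ≡ sumF g
sumF-cong {f = f} {g} f≗g = trans (sumF≡sum f) (trans (sum-cong-≗ f≗g) (sym (sumF≡sum g)))

sumF-zero : ∀ {n} {f : Fin n → ℚ} → (∀ i → f i ≡ 0ℚ) → sumF f ≡ 0ℚ
sumF-zero {n} {f} f≗0 = trans (sumF≡sum f) (trans (sum-cong-≗ f≗0) (sum-replicate-zero n))

sumF-+ : ∀ {n} (f g : Fin n → ℚ) → sumF (λ i → f i + g i) ≡ sumF f + sumF g
sumF-+ f g = trans (sumF≡sum (λ i → f i + g i)) (trans (∑-distrib-+ f g) (sym (cong₂ _+_ (sumF≡sum f) (sumF≡sum g))))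

sumF-*ˡ : ∀ {n} (k : ℚ) (f : Fin n → ℚ) → sumF (λ i → k * f i) ≡ k * sumF f
sumF-*ˡ k f = trans (sumF≡sum (λ i → k * f i)) (sym (trans (cong (k *_) (sumF≡sum f)) (*-distribˡ-sum k f)))

sumF-comm : ∀ {m n} (f : Fin m → Fin n → ℚ) →
  sumF (λ i → sumF (λ j → f i j)) ≡ sumF (λ j → sumF (λ i → f i j))
sumF-comm f = begin
  sumF (λ i → sumF (f i))            ≡⟨ sumF-cong (λ i → sumF≡sum (f i)) ⟩
  sumF (λ i → sum (f i))             ≡⟨ sumF≡sum (λ i → sum (f i)) ⟩
  sum (λ i → sum (f i))              ≡⟨ ∑-comm f ⟩
  sum (λ j → sum (λ i → f i j))      ≡⟨ sumF≡sum (λ j → sum (λ i → f i j)) ⟨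
  sumF (λ j → sum (λ i → f i j))     ≡⟨ sumF-cong (λ j → sumF≡sum (λ i → f i j)) ⟨
  sumF (λ j → sumF (λ i → f i j))    ∎
  where open ≡-Reasoning

sumF-remove : ∀ {n} (k : Fin (suc n)) (f : Fin (suc n) → ℚ) → sumF f ≡ f k + sumF (f ∘ punchIn k)
sumF-remove k f = trans (sumF≡sum f) (trans (sum-remove f) (cong (f k +_) (sym (sumF≡sum (f ∘ punchIn k)))))

·-sumF : ∀ {n k} (a : Pt n) (μ : Fin k → ℚ) (p : Fin k → Pt n) →
  a · (λ v → sumF (λ i → μ i * p i v)) ≡ sumF (λ i → μ i * (a · p i))
·-sumF a μ p = begin
  sumF (λ v → a v * sumF (λ i → μ i * p i v))     ≡⟨ sumF-cong (λ v → sumF-*ˡ (a v) (λ i → μ i * p i v)) ⟨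
  sumF (λ v → sumF (λ i → a v * (μ i * p i v)))   ≡⟨ sumF-comm (λ v i → a v * (μ i * p i v)) ⟩
  sumF (λ i → sumF (λ v → a v * (μ i * p i v)))   ≡⟨ sumF-cong (λ i → sumF-cong (λ v → *-CS.x∙yz≈y∙xz (a v) (μ i) (p i v))) ⟩
  sumF (λ i → sumF (λ v → μ i * (a v * p i v)))   ≡⟨ sumF-cong (λ i → sumF-*ˡ (μ i) (λ v → a v * p i v)) ⟩
  sumF (λ i → μ i * (a · p i))                    ∎
  where open ≡-Reasoning

*-cancel-zeroˡ : ∀ {p q} → p ≢ 0ℚ → p * q ≡ 0ℚ → q ≡ 0ℚ
*-cancel-zeroˡ {p} {q} p≢0 pq≡0 = begin
  q                ≡⟨ *-identityˡ q ⟨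
  1ℚ * q           ≡⟨ cong (_* q) (*-inverseˡ p) ⟨
  1/ p * p * q     ≡⟨ *-assoc (1/ p) p q ⟩
  1/ p * (p * q)   ≡⟨ cong (1/ p *_) pq≡0 ⟩
  1/ p * 0ℚ        ≡⟨ *-zeroʳ (1/ p) ⟩
  0ℚ               ∎
  where
  open ≡-Reasoning
  instance
    p-nonZero : NonZero p
    p-nonZero = ≢-nonZero p≢0

*-≢0 : ∀ {p q} → p ≢ 0ℚ → q ≢ 0ℚ → p * q ≢ 0ℚ
*-≢0 p≢0 q≢0 = q≢0 ∘ *-cancel-zeroˡ p≢0

record LinearDependence {k n} (v : Fin k → Pt n) : Set where
  field
    coeff         : Fin k → ℚ
    pivot         : Fin k
    coeff≢0       : coeff pivot ≢ 0ℚ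
    combination≡0 : ∀ j → sumF (λ i → coeff i * v i j) ≡ 0ℚ

linearDependence : ∀ {n} (v : Fin (suc n) → Pt n) → LinearDependence v

-- Gaussian elimination on the first coordinate: if it vanishes on every vector, drop it.
linearDependence-zeroColumn : ∀ {n} (v : Fin (suc (suc n)) → Pt (suc n)) →
  (∀ i → v i zero ≡ 0ℚ) → LinearDependence v
linearDependence-zeroColumn v column≡0 = record
  { coeff = 0ℚ ◂ coeff
  ; pivot = suc pivot
  ; coeff≢0 = coeff≢0
  ; combination≡0 = λ
    { zero    → trans (0*-+ (v zero zero) _) (sumF-zero (λ i → trans (cong (coeff i *_) (column≡0 (suc i))) (*-zeroʳ (coeff i))))
    ; (suc j) → trans (0*-+ (v zero (suc j)) _) (combination≡0 j)
    }
  }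
  where
  open LinearDependence (linearDependence (λ i j → v (suc i) (suc j)))
  0*-+ : ∀ x y → 0ℚ * x + y ≡ y
  0*-+ x y = trans (cong (_+ y) (*-zeroˡ x)) (+-identityˡ y)

-- Otherwise use v k with first coordinate a ≢ 0 to clear the first coordinate of the others.
linearDependence-pivot : ∀ {n} (v : Fin (suc (suc n)) → Pt (suc n)) (k : Fin (suc (suc n))) →
  v k zero ≢ 0ℚ → LinearDependence v
linearDependence-pivot {n} v k a≢0 = record
  { coeff = μ
  ; pivot = punchIn k pivot
  ; coeff≢0 = subst (_≢ 0ℚ) (sym (insertAt-punchIn a*coeff k (- S) pivot)) (*-≢0 a≢0 coeff≢0)
  ; combination≡0 = λ
    { zero    → trans (reduce zero) (sumF-zero (λ i → trans (cong (coeff i *_) (a*b-b*a≡0 a (vᵢ i zero))) (*-zeroʳ (coeff i))))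
    ; (suc j) → trans (reduce (suc j)) (combination≡0 j)
    }
  }
  where
  a = v k zero
  vᵢ : Fin (suc n) → Pt (suc n)
  vᵢ = v ∘ punchIn k
  eliminated : Fin (suc n) → Pt (suc n)
  eliminated i j = a * vᵢ i j - vᵢ i zero * v k j
  open LinearDependence (linearDependence (λ i j → eliminated i (suc j)))
  S = sumF (λ i → coeff i * vᵢ i zero)
  a*b-b*a≡0 : ∀ x y → x * y - y * x ≡ 0ℚ
  a*b-b*a≡0 x y = trans (cong (λ t → x * y - t) (*-comm y x)) (+-inverseʳ (x * y))
  swap-terms : ∀ s x b t → - s * x + b * t ≡ b * t + - x * s
  swap-terms = solve 4 (λ s x b t → :- s :* x :+ b :* t := b :* t :+ :- x :* s) refl
  expand : ∀ c b x y z → c * (b * x - y * z) ≡ b * (c * x) + - z * (c * y)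
  expand = solve 5 (λ c b x y z → c :* (b :* x :- y :* z) := b :* (c :* x) :+ :- z :* (c :* y)) refl
  a*coeff : Fin (suc n) → ℚ
  a*coeff i = a * coeff i
  μ = insertAt a*coeff k (- S)
  reduce : ∀ j → sumF (λ t → μ t * v t j) ≡ sumF (λ i → coeff i * eliminated i j)
  reduce j = begin
    sumF (λ t → μ t * v t j)
      ≡⟨ sumF-remove k (λ t → μ t * v t j) ⟩
    μ k * v k j + sumF (λ i → μ (punchIn k i) * vᵢ i j)
      ≡⟨ cong₂ _+_ (cong (_* v k j) (insertAt-lookup a*coeff k (- S)))
           (sumF-cong (λ i → cong (_* vᵢ i j) (insertAt-punchIn a*coeff k (- S) i))) ⟩
    - S * v k j + sumF (λ i → a * coeff i * vᵢ i j)
      ≡⟨ cong (- S * v k j +_) (trans (sumF-cong (λ i → *-assoc a (coeff i) (vᵢ i j))) (sumF-*ˡ a T)) ⟩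
    - S * v k j + a * sumF T
      ≡⟨ swap-terms S (v k j) a (sumF T) ⟩
    a * sumF T + - v k j * S
      ≡⟨ cong₂ _+_ (sumF-*ˡ a T) (sumF-*ˡ (- v k j) (λ i → coeff i * vᵢ i zero)) ⟨
    sumF (λ i → a * T i) + sumF (λ i → - v k j * (coeff i * vᵢ i zero))
      ≡⟨ sumF-+ (λ i → a * T i) (λ i → - v k j * (coeff i * vᵢ i zero)) ⟨
    sumF (λ i → a * T i + - v k j * (coeff i * vᵢ i zero))
      ≡⟨ sumF-cong (λ i → expand (coeff i) a (vᵢ i j) (vᵢ i zero) (v k j)) ⟨
    sumF (λ i → coeff i * eliminated i j)
      ∎
    where
    open ≡-Reasoning
    T : Fin (suc n) → ℚ
    T i = coeff i * vᵢ i j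

linearDependence {zero} v = record
  { coeff = λ _ → 1ℚ ; pivot = zero ; coeff≢0 = λ () ; combination≡0 = λ () }
linearDependence {suc n} v with any? (λ k → ¬? (v k zero ≟ 0ℚ))
... | yes (k , a≢0) = linearDependence-pivot v k a≢0
... | no  noPivot   = linearDependence-zeroColumn v (λ k → decidable-stable (v k zero ≟ 0ℚ) (λ a≢0 → noPivot (k , a≢0)))

¬AffIndep-n+2 : ∀ {n} (p : Fin (suc (suc n)) → Pt n) → ¬ AffIndep p
¬AffIndep-n+2 p indep = coeff≢0 (indep coeff Σcoeff≡0 (combination≡0 ∘ suc) pivot)
  where
  open LinearDependence (linearDependence (λ i → 1ℚ ◂ p i))
  Σcoeff≡0 : sumF coeff ≡ 0ℚ
  Σcoeff≡0 = trans (sumF-cong (λ i → sym (*-identityʳ (coeff i)))) (combination≡0 zero)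

-- A linear relation among points of an affine hyperplane missing the origin is affine.
¬AffIndep-hyperplane : ∀ {n} (a : Pt n) {b : ℚ} → b ≢ 0ℚ →
  (p : Fin (suc n) → Pt n) → (∀ i → a · p i ≡ b) → ¬ AffIndep p
¬AffIndep-hyperplane a {b} b≢0 p on-hyperplane indep =
  coeff≢0 (indep coeff (*-cancel-zeroˡ b≢0 b*Σcoeff≡0) combination≡0 pivot)
  where
  open LinearDependence (linearDependence p)
  open ≡-Reasoning
  b*Σcoeff≡0 : b * sumF coeff ≡ 0ℚ
  b*Σcoeff≡0 = begin
    b * sumF coeff                             ≡⟨ sumF-*ˡ b coeff ⟨
    sumF (λ i → b * coeff i)                   ≡⟨ sumF-cong (λ i → trans (*-comm b (coeff i)) (cong (coeff i *_) (sym (on-hyperplane i)))) ⟩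
    sumF (λ i → coeff i * (a · p i))           ≡⟨ ·-sumF a coeff p ⟨
    a · (λ v → sumF (λ i → coeff i * p i v))   ≡⟨ sumF-zero (λ v → trans (cong (a v *_) (combination≡0 v)) (*-zeroʳ (a v))) ⟩
    0ℚ                                         ∎

Valid-Conv : ∀ {n} {a : Pt n} {b : ℚ} {S : PSet n} → Valid a b S → Valid a b (Conv S)
Valid-Conv {n} {a} {b} {S} valid x (L , L⊆S , Σweights≡1 , x≡combination) = begin
  a · x                        ≡⟨ sumF-cong (λ v → cong (a v *_) (x≡combination v)) ⟩
  a · combination L            ≤⟨ weighted-bound L L⊆S ⟩
  b * weight L                 ≡⟨ cong (b *_) Σweights≡1 ⟩
  b * 1ℚ                       ≡⟨ *-identityʳ b ⟩
  b                            ∎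
  where
  open ≤-Reasoning
  weight : List (ℚ × Pt n) → ℚ
  weight L = sumL (map proj₁ L)
  combination : List (ℚ × Pt n) → Pt n
  combination L v = sumL (map (λ (l , p) → l * p v) L)
  weighted-bound : ∀ L → All (λ (l , p) → (0ℚ ≤ l) × S p) L → a · combination L ≤ b * weight L
  weighted-bound [] All.[] = ≤-reflexive (trans (sumF-zero (λ v → *-zeroʳ (a v))) (sym (*-zeroʳ b)))
  weighted-bound ((l , p) ∷ L) ((0≤l , p∈S) All.∷ L⊆S) = begin
    a · combination ((l , p) ∷ L)              ≡⟨ sumF-cong (λ v → trans (*-distribˡ-+ (a v) _ _) (cong (_+ _) (*-CS.x∙yz≈y∙xz (a v) l (p v)))) ⟩
    sumF (λ v → l * (a v * p v) + a v * combination L v)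
                                               ≡⟨ trans (sumF-+ (λ v → l * (a v * p v)) _) (cong (_+ _) (sumF-*ˡ l (λ v → a v * p v))) ⟩
    l * (a · p) + a · combination L            ≤⟨ +-mono-≤ (*-monoˡ-≤-nonNeg l {{nonNegative 0≤l}} (valid p p∈S)) (weighted-bound L L⊆S) ⟩
    l * b + b * weight L                       ≡⟨ cong (_+ b * weight L) (*-comm l b) ⟩
    b * l + b * weight L                       ≡⟨ *-distribˡ-+ b l (weight L) ⟨
    b * weight ((l , p) ∷ L)                   ∎

Adj-sym : ∀ G {v w} → Adj G v w → Adj G w v
Adj-sym G (v≢w , inj₁ e) = v≢w ∘ sym , inj₂ e
Adj-sym G (v≢w , inj₂ e) = v≢w ∘ sym , inj₁ e

Adj? : ∀ G v w → Dec (Adj G v w)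
Adj? G v w = ¬? (v ≟F w) ×-dec ((E G v w ≟B true) ⊎-dec (E G w v ≟B true))

RA? : ∀ G x → Dec (RA G x)
RA? G x =
  ((all? λ v → (0ℚ ≤? x v) ×-dec (x v ≤? 1ℚ)) ×-dec
   (all? λ v → all? λ w → Adj? G v w →-dec (x v + x w ≤? 1ℚ))) ×-dec
  (all? λ u → all? λ v → all? λ w →
     Adj? G u v →-dec (Adj? G v w →-dec (Adj? G u w →-dec (x u + x v + x w ≤? 7/5))))

decide-RA : ∀ {G x} → {True (RA? G x)} → RA G x
decide-RA {G} {x} {x∈RA} = toWitness x∈RA

RA-cong : ∀ G {x y : Pt (n G)} → (∀ v → x v ≡ y v) → RA G x → RA G y
RA-cong G x≗y ((bounds , edges) , triangles) =
  ((λ v → subst (λ t → (0ℚ ≤ t) × (t ≤ 1ℚ)) (x≗y v) (bounds v)) ,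
   (λ v w adj → subst (_≤ 1ℚ) (cong₂ _+_ (x≗y v) (x≗y w)) (edges v w adj))) ,
  (λ u v w a b c → subst (_≤ 7/5) (cong₂ _+_ (cong₂ _+_ (x≗y u) (x≗y v)) (x≗y w)) (triangles u v w a b c))

RA-pullback : ∀ {G H} (f : Fin (n H) → Fin (n G)) → (∀ {i j} → Adj H i j → Adj G (f i) (f j)) →
  ∀ {x} → RA G x → RA H (x ∘ f)
RA-pullback f f-adj ((bounds , edges) , triangles) =
  ((bounds ∘ f) , (λ v w adj → edges (f v) (f w) (f-adj adj))) ,
  (λ u v w a b c → triangles (f u) (f v) (f w) (f-adj a) (f-adj b) (f-adj c))

RA-1-neighbour : ∀ G {x u w} → RA G x → Adj G u w → x u ≡ 1ℚ → x w ≡ 0ℚ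
RA-1-neighbour G {x} {u} {w} ((bounds , edges) , _) uw xu≡1 = ≤-antisym xw≤0 (proj₁ (bounds w))
  where
  xw≤0 : x w ≤ 0ℚ
  xw≤0 = +-cancelˡ-≤ 1ℚ (subst₂ _≤_ (cong (_+ x w) xu≡1) (sym (+-identityʳ 1ℚ)) (edges u w uw))

zeroExtend : ∀ {m} (s : Fin m → Bool) → Pt (count s) → Pt m
zeroExtend {suc m} s x v with s zero
zeroExtend {suc m} s x zero    | true  = x zero
zeroExtend {suc m} s x (suc v) | true  = zeroExtend (s ∘ suc) (x ∘ suc) v
zeroExtend {suc m} s x zero    | false = 0ℚ
zeroExtend {suc m} s x (suc v) | false = zeroExtend (s ∘ suc) x v

zeroExtend-· : ∀ {m} (s : Fin m → Bool) (a : Pt m) (x : Pt (count s)) →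
  a · zeroExtend s x ≡ (a ∘ emb s) · x
zeroExtend-· {zero}  s a x = refl
zeroExtend-· {suc m} s a x with s zero
... | true  = cong (a zero * x zero +_) (zeroExtend-· (s ∘ suc) (a ∘ suc) (x ∘ suc))
... | false = trans (cong (_+ rest) (*-zeroʳ (a zero)))
                (trans (+-identityˡ rest) (zeroExtend-· (s ∘ suc) (a ∘ suc) x))
  where rest = (a ∘ suc) · zeroExtend (s ∘ suc) x

zeroExtend-cases : ∀ {m} (s : Fin m → Bool) (x : Pt (count s)) (v : Fin m) →
  (zeroExtend s x v ≡ 0ℚ) ⊎ ∃ λ i → emb s i ≡ v × zeroExtend s x v ≡ x i
zeroExtend-cases {suc m} s x v with s zero
zeroExtend-cases {suc m} s x zero    | true  = inj₂ (zero , refl , refl)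
zeroExtend-cases {suc m} s x (suc v) | true  with zeroExtend-cases (s ∘ suc) (x ∘ suc) v
... | inj₁ e             = inj₁ e
... | inj₂ (i , refl , e) = inj₂ (suc i , refl , e)
zeroExtend-cases {suc m} s x zero    | false = inj₁ refl
zeroExtend-cases {suc m} s x (suc v) | false with zeroExtend-cases (s ∘ suc) x v
... | inj₁ e             = inj₁ e
... | inj₂ (i , refl , e) = inj₂ (i , refl , e)

Adj-induced : ∀ G (s : Fin (n G) → Bool) {i j} → Adj G (emb s i) (emb s j) → Adj (Induced G s) i j
Adj-induced G s (emb-i≢emb-j , edge) = emb-i≢emb-j ∘ cong (emb s) , edge

RA-fromNonzero : ∀ G {y : Pt (n G)} →
  (∀ v → (0ℚ ≤ y v) × (y v ≤ 1ℚ)) →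
  (∀ v w → Adj G v w → y v ≢ 0ℚ → y w ≢ 0ℚ → y v + y w ≤ 1ℚ) →
  (∀ u v w → Adj G u v → Adj G v w → Adj G u w → y u ≢ 0ℚ → y v ≢ 0ℚ → y w ≢ 0ℚ → y u + y v + y w ≤ 7/5) →
  RA G y
RA-fromNonzero G {y} bounds edges triangles = (bounds , edges′) , triangles′
  where
  edges′ : ∀ v w → Adj G v w → y v + y w ≤ 1ℚ
  edges′ v w vw with y v ≟ 0ℚ | y w ≟ 0ℚ
  ... | yes yv≡0 | _ = ≤-trans (≤-reflexive (trans (cong (_+ y w) yv≡0) (+-identityˡ (y w)))) (proj₂ (bounds w))
  ... | no _ | yes yw≡0 = ≤-trans (≤-reflexive (trans (cong (y v +_) yw≡0) (+-identityʳ (y v)))) (proj₂ (bounds v))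
  ... | no yv≢0 | no yw≢0 = edges v w vw yv≢0 yw≢0
  triangles′ : ∀ u v w → Adj G u v → Adj G v w → Adj G u w → y u + y v + y w ≤ 7/5
  triangles′ u v w uv vw uw with y u ≟ 0ℚ | y v ≟ 0ℚ | y w ≟ 0ℚ
  ... | yes yu≡0 | _ | _ = ≤-trans (≤-reflexive (+-zero₁ yu≡0)) (≤1⇒≤7/5 (edges′ v w vw))
  ... | no _ | yes yv≡0 | _ = ≤-trans (≤-reflexive (+-zero₂ (y u) yv≡0)) (≤1⇒≤7/5 (edges′ u w uw))
  ... | no _ | no _ | yes yw≡0 = ≤-trans (≤-reflexive (+-zero₃ (y u) (y v) yw≡0)) (≤1⇒≤7/5 (edges′ u v uv))
  ... | no yu≢0 | no yv≢0 | no yw≢0 = triangles u v w uv vw uw yu≢0 yv≢0 yw≢0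

RA-zeroExtend : ∀ G (s : Fin (n G) → Bool) {x} → RA (Induced G s) x → RA G (zeroExtend s x)
RA-zeroExtend G s {x} ((bounds , edges) , triangles) = RA-fromNonzero G bounds′ edges′ triangles′
  where
  y = zeroExtend s x
  adj = Adj-induced G s
  inside : ∀ {v} → y v ≢ 0ℚ → ∃ λ i → emb s i ≡ v × y v ≡ x i
  inside {v} yv≢0 with zeroExtend-cases s x v
  ... | inj₁ yv≡0  = ⊥-elim (yv≢0 yv≡0)
  ... | inj₂ found = found
  bounds′ : ∀ v → (0ℚ ≤ y v) × (y v ≤ 1ℚ)
  bounds′ v with zeroExtend-cases s x v
  ... | inj₁ yv≡0              rewrite yv≡0 = ≤-refl , decide-≤
  ... | inj₂ (i , refl , yv≡xi) rewrite yv≡xi = bounds i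
  edges′ : ∀ v w → Adj G v w → y v ≢ 0ℚ → y w ≢ 0ℚ → y v + y w ≤ 1ℚ
  edges′ v w vw yv≢0 yw≢0 with inside yv≢0 | inside yw≢0
  ... | i , refl , yv≡xi | j , refl , yw≡xj =
    subst (_≤ 1ℚ) (sym (cong₂ _+_ yv≡xi yw≡xj)) (edges i j (adj vw))
  triangles′ : ∀ u v w → Adj G u v → Adj G v w → Adj G u w →
    y u ≢ 0ℚ → y v ≢ 0ℚ → y w ≢ 0ℚ → y u + y v + y w ≤ 7/5
  triangles′ u v w uv vw uw yu≢0 yv≢0 yw≢0 with inside yu≢0 | inside yv≢0 | inside yw≢0
  ... | i , refl , yu≡xi | j , refl , yv≡xj | k , refl , yw≡xk =
    subst (_≤ 7/5) (sym (cong₂ _+_ (cong₂ _+_ yu≡xi yv≡xj) yw≡xk)) (triangles i j k (adj uv) (adj vw) (adj uw))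

StableChar⇒RA : ∀ G {y} → StableChar G y → RA G y
StableChar⇒RA G {y} (binary , stable) = RA-fromNonzero G bounds
  (λ v w vw yv≢0 yw≢0 → ⊥-elim (stable v w vw (≡1 yv≢0 , ≡1 yw≢0)))
  (λ u v w uv _ _ yu≢0 yv≢0 _ → ⊥-elim (stable u v uv (≡1 yu≢0 , ≡1 yv≢0)))
  where
  ≡1 : ∀ {v} → y v ≢ 0ℚ → y v ≡ 1ℚ
  ≡1 {v} yv≢0 with binary v
  ... | inj₁ yv≡0 = ⊥-elim (yv≢0 yv≡0)
  ... | inj₂ yv≡1 = yv≡1
  bounds : ∀ v → (0ℚ ≤ y v) × (y v ≤ 1ℚ)
  bounds v with binary v
  ... | inj₁ yv≡0 rewrite yv≡0 = ≤-refl , decide-≤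
  ... | inj₂ yv≡1 rewrite yv≡1 = decide-≤ , ≤-refl

Valid-induced : ∀ G (s : Fin (n G) → Bool) {a b} → Valid a b (RA G) → Valid (a ∘ emb s) b (RA (Induced G s))
Valid-induced G s {a} {b} valid x x∈RA =
  subst (_≤ b) (zeroExtend-· s a x) (valid (zeroExtend s x) (RA-zeroExtend G s x∈RA))

condB : CondB RA
condB G a b (valid , _) = Valid-induced G (supp a) {a} valid

Conv-singleton : ∀ {n} {S : PSet n} {x} → S x → Conv S x
Conv-singleton {x = x} x∈S =
  (1ℚ , x) ∷ [] , (decide-≤ , x∈S) All.∷ All.[] , refl , λ v → sym (trans (+-identityʳ _) (*-identityˡ (x v)))

OneSumP-intro : ∀ {n₁ m} {P : PSet n₁} {Q : PSet (suc m)} {i j} →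
  (∀ {x x′} → (∀ k → x k ≡ x′ k) → P x → P x′) →
  (∀ {y y′} → (∀ l → y l ≡ y′ l) → Q y → Q y′) →
  ∀ {x y z} → P x → Q y → x i ≡ y j →
  (∀ k → z (k ↑ˡ m) ≡ x k) → (∀ l → z (n₁ ↑ʳ l) ≡ y (punchIn j l)) → OneSumP P Q i j z
OneSumP-intro P-resp Q-resp {x} {y} x∈P y∈Q xi≡yj z-left z-right =
  x ++ y ,
  Conv-singleton (P-resp (λ k → sym (lookup-++ˡ x y k)) x∈P ,
                  Q-resp (λ l → sym (lookup-++ʳ x y l)) y∈Q ,
                  trans (lookup-++ˡ x y _) (trans xi≡yj (sym (lookup-++ʳ x y _)))) ,
  (λ k → trans (z-left k) (sym (lookup-++ˡ x y k))) ,
  (λ l → trans (z-right l) (sym (lookup-++ʳ x y _)))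

Adj-map : ∀ {G H} (f : Fin (n G) → Fin (n H)) → (∀ {a b} → f a ≡ f b → a ≡ b) →
  (∀ {a b} → E G a b ≡ true → E H (f a) (f b) ≡ true) → ∀ {a b} → Adj G a b → Adj H (f a) (f b)
Adj-map f f-injective f-edge (a≢b , inj₁ e) = a≢b ∘ f-injective , inj₁ (f-edge e)
Adj-map f f-injective f-edge (a≢b , inj₂ e) = a≢b ∘ f-injective , inj₂ (f-edge e)

module OneSum (G₁ : Graph) {m : ℕ} (E₂ : Fin (suc m) → Fin (suc m) → Bool) (v₁ : Fin (n G₁)) (v₂ : Fin (suc m)) where
  G₂ : Graph
  G₂ = mkGraph (suc m) E₂

  G : Graph
  G = OneSumG G₁ E₂ v₁ v₂

  embed₁ : Fin (n G₁) → Fin (n G)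
  embed₁ k = k ↑ˡ m

  embed₂ : Fin (suc m) → Fin (n G)
  embed₂ l with v₂ ≟F l
  ... | yes _     = embed₁ v₁
  ... | no v₂≢l   = n G₁ ↑ʳ punchOut v₂≢l

  part1-embed₁ : ∀ k → part1 {n G₁} {m} (embed₁ k) ≡ just k
  part1-embed₁ k rewrite splitAt-↑ˡ (n G₁) k m = refl

  part2-v₁ : part2 v₁ v₂ (embed₁ v₁) ≡ just v₂
  part2-v₁ rewrite splitAt-↑ˡ (n G₁) v₁ m with v₁ ≟F v₁
  ... | yes _     = refl
  ... | no v₁≢v₁  = ⊥-elim (v₁≢v₁ refl)

  part2-↑ʳ : ∀ l → part2 v₁ v₂ (n G₁ ↑ʳ l) ≡ just (punchIn v₂ l)
  part2-↑ʳ l rewrite splitAt-↑ʳ (n G₁) m l = refl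

  part2-embed₂ : ∀ l → part2 v₁ v₂ (embed₂ l) ≡ just l
  part2-embed₂ l with v₂ ≟F l
  ... | yes refl  = part2-v₁
  ... | no v₂≢l   = trans (part2-↑ʳ (punchOut v₂≢l)) (cong just (punchIn-punchOut v₂≢l))

  embed₂-injective : ∀ {a b} → embed₂ a ≡ embed₂ b → a ≡ b
  embed₂-injective {a} {b} eq = just-injective (trans (sym (part2-embed₂ a)) (trans (cong (part2 v₁ v₂) eq) (part2-embed₂ b)))

  embed₂-v₂ : embed₂ v₂ ≡ embed₁ v₁
  embed₂-v₂ with v₂ ≟F v₂
  ... | yes _     = refl
  ... | no v₂≢v₂  = ⊥-elim (v₂≢v₂ refl)

  embed₂-punchIn : ∀ l → embed₂ (punchIn v₂ l) ≡ n G₁ ↑ʳ l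
  embed₂-punchIn l with v₂ ≟F punchIn v₂ l
  ... | yes v₂≡   = ⊥-elim (punchInᵢ≢i v₂ l (sym v₂≡))
  ... | no v₂≢    = cong (n G₁ ↑ʳ_) (trans (punchOut-cong v₂ refl) (punchOut-punchIn v₂))

  Adj-embed₁ : ∀ {a b} → Adj G₁ a b → Adj G (embed₁ a) (embed₁ b)
  Adj-embed₁ = Adj-map {G₁} {G} embed₁ (↑ˡ-injective m _ _) edge
    where
    edge : ∀ {a b} → E G₁ a b ≡ true → E G (embed₁ a) (embed₁ b) ≡ true
    edge {a} {b} e rewrite part1-embed₁ a | part1-embed₁ b | e = refl

  Adj-embed₂ : ∀ {a b} → Adj G₂ a b → Adj G (embed₂ a) (embed₂ b)
  Adj-embed₂ = Adj-map {G₂} {G} embed₂ embed₂-injective edge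
    where
    edge : ∀ {a b} → E₂ a b ≡ true → E G (embed₂ a) (embed₂ b) ≡ true
    edge {a} {b} e rewrite part2-embed₂ a | part2-embed₂ b | e = ∨-zeroʳ _

condC : CondC RA
condC G₁ E₂ v₁ v₂ z z∈RA =
  OneSumP-intro (RA-cong G₁) (RA-cong G₂) {z = z}
    (RA-pullback {G} {G₁} embed₁ Adj-embed₁ z∈RA) (RA-pullback {G} {G₂} embed₂ Adj-embed₂ z∈RA)
    (cong z (sym embed₂-v₂)) (λ k → refl) (λ l → cong z (sym (embed₂-punchIn l)))
  where open OneSum G₁ E₂ v₁ v₂

unit : ∀ {n} → Fin n → Pt n
unit zero    zero    = 1ℚ
unit zero    (suc j) = 0ℚ
unit (suc i) zero    = 0ℚ
unit (suc i) (suc j) = unit i j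

sumF-unit : ∀ {n} (f : Fin n → ℚ) j → sumF (λ i → f i * unit i j) ≡ f j
sumF-unit {suc n} f zero    = trans (cong₂ _+_ (*-identityʳ (f zero)) (sumF-zero (λ i → *-zeroʳ (f (suc i)))))
                                    (+-identityʳ (f zero))
sumF-unit {suc n} f (suc j) = trans (cong₂ _+_ (*-zeroʳ (f zero)) (sumF-unit (f ∘ suc) j))
                                    (+-identityˡ (f (suc j)))

unit-binary : ∀ {n} (i : Fin n) → Binary (unit i)
unit-binary zero    zero    = inj₂ refl
unit-binary zero    (suc j) = inj₁ refl
unit-binary (suc i) zero    = inj₁ refl
unit-binary (suc i) (suc j) = unit-binary i j

unit≡1⇒≡ : ∀ {n} {i j : Fin n} → unit i j ≡ 1ℚ → i ≡ j
unit≡1⇒≡ {i = zero}  {zero}  _ = refl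
unit≡1⇒≡ {i = suc i} {suc j} e = cong suc (unit≡1⇒≡ e)

origin : ∀ {n} → Pt n
origin _ = 0ℚ

originUnits-StableChar : ∀ G i → StableChar G ((origin ◂ unit) i)
originUnits-StableChar G zero    = (λ _ → inj₁ refl) , λ _ _ _ ()
originUnits-StableChar G (suc i) = unit-binary i , λ v w (v≢w , _) (iv≡1 , iw≡1) →
  v≢w (trans (sym (unit≡1⇒≡ {i = i} iv≡1)) (unit≡1⇒≡ {i = i} iw≡1))

AffIndep-tail : ∀ {n k} {p : Fin (suc k) → Pt n} → AffIndep p → AffIndep (p ∘ suc)
AffIndep-tail {p = p} indep λc Σλc≡0 combination≡0 i =
  indep (0ℚ ◂ λc) (trans (+-identityˡ (sumF λc)) Σλc≡0)
    (λ v → trans (cong (_+ rest v) (*-zeroˡ (p zero v))) (trans (+-identityˡ (rest v)) (combination≡0 v))) (suc i)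
  where
  rest : Fin _ → ℚ
  rest v = sumF (λ i → λc i * p (suc i) v)

AffIndep-originUnits : ∀ {n} → AffIndep {n} (origin ◂ unit)
AffIndep-originUnits λc Σλc≡0 combination≡0 = λc≡0
  where
  λc-suc≡0 : ∀ j → λc (suc j) ≡ 0ℚ
  λc-suc≡0 j = trans (sym (trans (cong (_+ rest) (*-zeroʳ (λc zero))) (trans (+-identityˡ rest) (sumF-unit (λc ∘ suc) j))))
                     (combination≡0 j)
    where rest = sumF (λ i → λc (suc i) * unit i j)
  λc≡0 : ∀ i → λc i ≡ 0ℚ
  λc≡0 zero    = trans (sym (trans (cong (λc zero +_) (sumF-zero λc-suc≡0)) (+-identityʳ (λc zero)))) Σλc≡0
  λc≡0 (suc j) = λc-suc≡0 j

AffIndep-shiftedUnits : ∀ {n} (c : Pt n) {s} → s ≢ 0ℚ → AffIndep (λ i v → c v + s * unit i v)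
AffIndep-shiftedUnits c {s} s≢0 λc Σλc≡0 combination≡0 j = *-cancel-zeroˡ s≢0 (begin
  s * λc j                                              ≡⟨ pad (c j) s (λc j) ⟩
  c j * 0ℚ + s * λc j                                   ≡⟨ cong₂ (λ a b → c j * a + s * b) Σλc≡0 (sumF-unit λc j) ⟨
  c j * sumF λc + s * sumF (λ i → λc i * unit i j)      ≡⟨ cong₂ _+_ (sumF-*ˡ (c j) λc) (sumF-*ˡ s (λ i → λc i * unit i j)) ⟨
  sumF (λ i → c j * λc i) + sumF (λ i → s * (λc i * unit i j))
                                                        ≡⟨ sumF-+ (λ i → c j * λc i) (λ i → s * (λc i * unit i j)) ⟨
  sumF (λ i → c j * λc i + s * (λc i * unit i j))       ≡⟨ sumF-cong (λ i → distribute (λc i) (c j) s (unit i j)) ⟨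
  sumF (λ i → λc i * (c j + s * unit i j))              ≡⟨ combination≡0 j ⟩
  0ℚ                                                    ∎)
  where
  open ≡-Reasoning
  distribute : ∀ l a b u → l * (a + b * u) ≡ a * l + b * (l * u)
  distribute = solve 4 (λ l a b u → l :* (a :+ b :* u) := a :* l :+ b :* (l :* u)) refl
  pad : ∀ a b l → b * l ≡ a * 0ℚ + b * l
  pad a b l = sym (trans (cong (_+ b * l) (*-zeroʳ a)) (+-identityˡ (b * l)))

K3 : Graph
K3 = mkGraph 3 (λ _ _ → true)

Adj-K3 : ∀ {v w} → v ≢ w → Adj K3 v w
Adj-K3 v≢w = v≢w , inj₁ refl

ones : Pt 3
ones _ = 1ℚ

ones-· : ∀ x → ones · x ≡ x zero + x (suc zero) + x (suc (suc zero))
ones-· x = sum-ones (x zero) (x (suc zero)) (x (suc (suc zero)))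
  where
  sum-ones : ∀ a b c → 1ℚ * a + (1ℚ * b + (1ℚ * c + 0ℚ)) ≡ a + b + c
  sum-ones = solve 3 (λ a b c → con 1ℚ :* a :+ (con 1ℚ :* b :+ (con 1ℚ :* c :+ con 0ℚ)) := a :+ b :+ c) refl

facePoint : Fin 3 → Pt 3
facePoint i v = 2/5 + ℤ.+ 1 / 5 * unit i v

facePoint-onFace : ∀ i → RA K3 (facePoint i) × (ones · facePoint i ≡ 7/5)
facePoint-onFace zero             = decide-RA , refl
facePoint-onFace (suc zero)       = decide-RA , refl
facePoint-onFace (suc (suc zero)) = decide-RA , refl

facet-RA-K3 : FacetDefining ones 7/5 (RA K3)
facet-RA-K3 = valid , 3 ,
  (((origin ◂ unit) , (StableChar⇒RA K3 ∘ originUnits-StableChar K3) , AffIndep-originUnits) ,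
   (λ p _ → ¬AffIndep-n+2 p)) ,
  ((facePoint , facePoint-onFace , AffIndep-shiftedUnits (λ _ → 2/5) {ℤ.+ 1 / 5} (λ ())) ,
   (λ p p∈face → ¬AffIndep-hyperplane ones (λ ()) p (proj₂ ∘ p∈face)))
  where
  valid : Valid ones 7/5 (RA K3)
  valid x (_ , triangles) = subst (_≤ 7/5) (sym (ones-· x))
    (triangles zero (suc zero) (suc (suc zero)) (Adj-K3 (λ ())) (Adj-K3 (λ ())) (Adj-K3 (λ ())))

StableChar-K3-≤1 : Valid ones 1ℚ (StableChar K3)
StableChar-K3-≤1 p p-stable with proj₁ p-stable zero
... | inj₁ p₀≡0 = begin
  ones · p                                  ≡⟨ ones-· p ⟩
  p zero + p (suc zero) + p (suc (suc zero)) ≡⟨ +-zero₁ p₀≡0 ⟩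
  p (suc zero) + p (suc (suc zero))          ≤⟨ proj₂ (proj₁ (StableChar⇒RA K3 p-stable)) _ _ (Adj-K3 (λ ())) ⟩
  1ℚ                                         ∎
  where open ≤-Reasoning
... | inj₂ p₀≡1 = ≤-reflexive (begin
  ones · p                                  ≡⟨ ones-· p ⟩
  p zero + p (suc zero) + p (suc (suc zero)) ≡⟨ cong₂ _+_ (cong₂ _+_ p₀≡1 (neighbour≡0 zero)) (neighbour≡0 (suc zero)) ⟩
  1ℚ + 0ℚ + 0ℚ                               ≡⟨⟩
  1ℚ                                         ∎)
  where
  open ≡-Reasoning
  neighbour≡0 : ∀ v → p (suc v) ≡ 0ℚ
  neighbour≡0 v = RA-1-neighbour K3 (StableChar⇒RA K3 p-stable) (Adj-K3 (λ ())) p₀≡1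

¬facet-Pstab-K3 : ¬ FacetDefining ones 7/5 (Pstab K3)
¬facet-Pstab-K3 (_ , zero , (_ , no-two-independent) , _) =
  no-two-independent (unit ∘ suc) (λ i → Conv-singleton (originUnits-StableChar K3 (suc (suc i))))
    (AffIndep-tail {p = unit} (AffIndep-tail {p = origin ◂ unit} AffIndep-originUnits))
¬facet-Pstab-K3 (_ , suc r , _ , (p , p∈face , _) , _) = toWitnessFalse {a? = 7/5 ≤? 1ℚ} _
  (subst (_≤ 1ℚ) (proj₂ (p∈face zero)) (Valid-Conv {a = ones} {S = StableChar K3} StableChar-K3-≤1 (p zero) (proj₁ (p∈face zero))))

¬condA : ¬ CondA RA
¬condA condA = ¬facet-Pstab-K3 (condA K3 ones 7/5 facet-RA-K3)

toℚ : Bool → ℚ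
toℚ true  = 1ℚ
toℚ false = 0ℚ

χ : ∀ {k} → (Fin k → Bool) → Pt k
χ b v = toℚ (b v)

χ-binary : ∀ {k} (b : Fin k → Bool) → Binary (χ b)
χ-binary b v with b v
... | true  = inj₂ refl
... | false = inj₁ refl

toℚ≡1⇒true : ∀ {t} → toℚ t ≡ 1ℚ → t ≡ true
toℚ≡1⇒true {true} _ = refl

binary≡χ : ∀ {k} {y : Pt k} → Binary y → ∀ v → y v ≡ χ (λ u → isYes (y u ≟ 1ℚ)) v
binary≡χ {y = y} binary v with y v ≟ 1ℚ | binary v
... | yes yv≡1 | _         = yv≡1
... | no _     | inj₁ yv≡0 = yv≡0
... | no yv≢1  | inj₂ yv≡1 = ⊥-elim (yv≢1 yv≡1)

IsStable : (G : Graph) → (Fin (n G) → Bool) → Set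
IsStable G b = ∀ {v w} → Adj G v w → ¬ (b v ≡ true × b w ≡ true)

χ-StableChar : ∀ G {b} → IsStable G b → StableChar G (χ b)
χ-StableChar G {b} stable = χ-binary b , λ v w vw (bv≡1 , bw≡1) → stable vw (toℚ≡1⇒true bv≡1 , toℚ≡1⇒true bw≡1)

RA-χ⇒IsStable : ∀ G {b} → RA G (χ b) → IsStable G b
RA-χ⇒IsStable G {b} ((_ , edges) , _) {v} {w} vw (bv , bw) =
  toWitnessFalse {a? = 1ℚ + 1ℚ ≤? 1ℚ} _ (subst₂ (λ s t → toℚ s + toℚ t ≤ 1ℚ) bv bw (edges v w vw))

Maximum : ∀ {A : Set} → (A → Set) → (A → ℚ) → Set
Maximum {A} Q f = ∃ λ (a : A) → Q a × ∀ a′ → Q a′ → f a′ ≤ f a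

maximum? : ∀ k {Q : Vec Bool k → Set} → Decidable Q → (f : Vec Bool k → ℚ) →
  Maximum Q f ⊎ (∀ b → ¬ Q b)
maximum? zero Q? f with Q? []ᵛ
... | yes q = inj₁ ([]ᵛ , q , λ { []ᵛ _ → ≤-refl })
... | no ¬q = inj₂ λ { []ᵛ → ¬q }
maximum? (suc k) Q? f with maximum? k (Q? ∘ (true ∷ᵛ_)) (f ∘ (true ∷ᵛ_)) | maximum? k (Q? ∘ (false ∷ᵛ_)) (f ∘ (false ∷ᵛ_))
... | inj₂ none₁ | inj₂ none₀ = inj₂ λ { (true ∷ᵛ b) → none₁ b ; (false ∷ᵛ b) → none₀ b }
... | inj₁ (b₁ , q₁ , max₁) | inj₂ none₀ =
  inj₁ (true ∷ᵛ b₁ , q₁ , λ { (true ∷ᵛ b) q → max₁ b q ; (false ∷ᵛ b) q → ⊥-elim (none₀ b q) })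
... | inj₂ none₁ | inj₁ (b₀ , q₀ , max₀) =
  inj₁ (false ∷ᵛ b₀ , q₀ , λ { (true ∷ᵛ b) q → ⊥-elim (none₁ b q) ; (false ∷ᵛ b) q → max₀ b q })
... | inj₁ (b₁ , q₁ , max₁) | inj₁ (b₀ , q₀ , max₀) with ≤-total (f (true ∷ᵛ b₁)) (f (false ∷ᵛ b₀))
...   | inj₁ f₁≤f₀ = inj₁ (false ∷ᵛ b₀ , q₀ , λ { (true ∷ᵛ b) q → ≤-trans (max₁ b q) f₁≤f₀ ; (false ∷ᵛ b) q → max₀ b q })
...   | inj₂ f₀≤f₁ = inj₁ (true ∷ᵛ b₁ , q₁ , λ { (true ∷ᵛ b) q → max₁ b q ; (false ∷ᵛ b) q → ≤-trans (max₀ b q) f₀≤f₁ })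

positive-lowerBound : ∀ {k} (b : ℚ) (f : Fin k → ℚ) → 0ℚ < b → (∀ i → 0ℚ < f i) →
  ∃ λ ε → 0ℚ < ε × ε ≤ b × ∀ i → ε ≤ f i
positive-lowerBound {zero}  b f 0<b _   = b , 0<b , ≤-refl , λ ()
positive-lowerBound {suc k} b f 0<b 0<f with positive-lowerBound (b ⊓ f zero) (f ∘ suc) 0<b⊓f₀ (0<f ∘ suc)
  where
  0<b⊓f₀ : 0ℚ < b ⊓ f zero
  0<b⊓f₀ with ⊓-sel b (f zero)
  ... | inj₁ b⊓f₀≡b  rewrite b⊓f₀≡b  = 0<b
  ... | inj₂ b⊓f₀≡f₀ rewrite b⊓f₀≡f₀ = 0<f zero
... | ε , 0<ε , ε≤b⊓f₀ , ε≤f∘suc =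
  ε , 0<ε , ≤-trans ε≤b⊓f₀ (p⊓q≤p b (f zero)) ,
  λ { zero → ≤-trans ε≤b⊓f₀ (p⊓q≤q b (f zero)) ; (suc i) → ε≤f∘suc i }

≤∧≢⇒< : ∀ {p q} → p ≤ q → p ≢ q → p < q
≤∧≢⇒< {p} {q} p≤q p≢q with q ≤? p
... | yes q≤p = ⊥-elim (p≢q (≤-antisym p≤q q≤p))
... | no  q≰p = ≰⇒> q≰p

data Integrality (q : ℚ) : Set where
  at0  : q ≡ 0ℚ → Integrality q
  at1  : q ≡ 1ℚ → Integrality q
  frac : q ≢ 0ℚ → q ≢ 1ℚ → Integrality q

integrality : ∀ q → Integrality q
integrality q with q ≟ 0ℚ | q ≟ 1ℚ
... | yes q≡0 | _       = at0 q≡0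
... | no _    | yes q≡1 = at1 q≡1
... | no q≢0  | no q≢1  = frac q≢0 q≢1

round : ∀ {q} → Integrality q → Bool → Bool
round (at0 _)    _ = false
round (at1 _)    _ = true
round (frac _ _) t = t

round-agrees : ∀ {q} (l : Integrality q) t → (q ≡ 0ℚ → round l t ≡ false) × (q ≡ 1ℚ → round l t ≡ true)
round-agrees (at0 q≡0)      t = (λ _ → refl) , λ q≡1 → ⊥-elim (0≢1 (trans (sym q≡0) q≡1))
round-agrees (at1 q≡1)      t = (λ q≡0 → ⊥-elim (0≢1 (trans (sym q≡0) q≡1))) , λ _ → refl
round-agrees (frac q≢0 q≢1) t = ⊥-elim ∘ q≢0 , ⊥-elim ∘ q≢1

round≡true : ∀ {q} (l : Integrality q) {t} → round l t ≡ true → q ≢ 0ℚ × (q ≡ 1ℚ ⊎ t ≡ true)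
round≡true (at1 q≡1)    _      = (λ q≡0 → 0≢1 (trans (sym q≡0) q≡1)) , inj₁ q≡1
round≡true (frac q≢0 _) t≡true = q≢0 , inj₂ t≡true

-- Only fractional coordinates limit the step ε; integral ones get the dummy bound 1.
headroom : ∀ {q} → Integrality q → ℚ
headroom {q} (frac _ _) = 1ℚ - q
headroom     _          = 1ℚ

headroom-pos : ∀ {q} (l : Integrality q) → q ≤ 1ℚ → 0ℚ < headroom l
headroom-pos (at0 _)        _   = decide-<
headroom-pos (at1 _)        _   = decide-<
headroom-pos {q} (frac _ q≢1) q≤1 =
  subst (_< 1ℚ - q) (+-inverseʳ q) (+-monoˡ-< (- q) (≤∧≢⇒< q≤1 q≢1))

-- nudge l t ε = q + ε (t - round l t) (nudge-linear): only integral coordinates move, by ε towards t.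
nudge : ∀ {q} → Integrality q → Bool → ℚ → ℚ
nudge     (at0 _) true  ε = ε
nudge     (at1 _) false ε = 1ℚ - ε
nudge {q} _       _     ε = q

nudge-linear : ∀ {q} (l : Integrality q) t ε → nudge l t ε + ε * toℚ (round l t) ≡ q + ε * toℚ t
nudge-linear (at0 refl)   true  ε = raise ε
  where
  raise : ∀ e → e + e * 0ℚ ≡ 0ℚ + e * 1ℚ
  raise = solve 1 (λ e → e :+ e :* con 0ℚ := con 0ℚ :+ e :* con 1ℚ) refl
nudge-linear (at0 refl)   false ε = refl
nudge-linear (at1 refl)   true  ε = refl
nudge-linear (at1 refl)   false ε = lower ε
  where
  lower : ∀ e → 1ℚ - e + e * 1ℚ ≡ 1ℚ + e * 0ℚ
  lower = solve 1 (λ e → con 1ℚ :- e :+ e :* con 1ℚ := con 1ℚ :+ e :* con 0ℚ) refl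
nudge-linear (frac _ _)   t     ε = refl

1-ε+ε : ∀ e → 1ℚ - e + e ≡ 1ℚ
1-ε+ε = solve 1 (λ e → con 1ℚ :- e :+ e := con 1ℚ) refl

q+[1-q] : ∀ q → q + (1ℚ - q) ≡ 1ℚ
q+[1-q] = solve 1 (λ q → q :+ (con 1ℚ :- q) := con 1ℚ) refl

module Nudge {ε : ℚ} (0≤ε : 0ℚ ≤ ε) (ε≤1 : ε ≤ 1ℚ) where
  1-ε≤1 : 1ℚ - ε ≤ 1ℚ
  1-ε≤1 = subst₂ _≤_ (+-identityʳ (1ℚ - ε)) (1-ε+ε ε) (+-monoʳ-≤ (1ℚ - ε) 0≤ε)

  nudge-bounds : ∀ {q} (l : Integrality q) t → 0ℚ ≤ q → q ≤ 1ℚ → (0ℚ ≤ nudge l t ε) × (nudge l t ε ≤ 1ℚ)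
  nudge-bounds (at0 refl) true  _ _ = 0≤ε , ε≤1
  nudge-bounds (at0 refl) false _ _ = ≤-refl , decide-≤
  nudge-bounds (at1 refl) true  _ _ = decide-≤ , ≤-refl
  nudge-bounds (at1 refl) false _ _ = subst (_≤ 1ℚ - ε) (+-inverseʳ ε) (+-monoˡ-≤ (- ε) ε≤1) , 1-ε≤1
  nudge-bounds (frac _ _) t 0≤q q≤1 = 0≤q , q≤1

  nudge-false-≤ : ∀ {q} (l : Integrality q) → nudge l false ε ≤ q
  nudge-false-≤ (at0 refl) = ≤-refl
  nudge-false-≤ (at1 refl) = 1-ε≤1
  nudge-false-≤ (frac _ _) = ≤-refl

  nudge-false-room : ∀ {q} (l : Integrality q) → ε ≤ headroom l → nudge l false ε + ε ≤ 1ℚ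
  nudge-false-room (at0 refl) _   = subst (_≤ 1ℚ) (sym (+-identityˡ ε)) ε≤1
  nudge-false-room (at1 refl) _   = ≤-reflexive (1-ε+ε ε)
  nudge-false-room {q} (frac _ _) ε≤1-q = subst (q + ε ≤_) (q+[1-q] q) (+-monoʳ-≤ q ε≤1-q)

  nudge-≤-or-raised : ∀ {q} (l : Integrality q) t → nudge l t ε ≤ q ⊎ (t ≡ true × nudge l t ε ≡ ε)
  nudge-≤-or-raised (at0 refl) true  = inj₂ (refl , refl)
  nudge-≤-or-raised (at0 refl) false = inj₁ ≤-refl
  nudge-≤-or-raised (at1 refl) true  = inj₁ ≤-refl
  nudge-≤-or-raised (at1 refl) false = inj₁ 1-ε≤1
  nudge-≤-or-raised (frac _ _) t     = inj₁ ≤-refl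

module BestStableSet (G : Graph) (c : Pt (n G)) where
  empty-stable : IsStable G (lookup (replicate (n G) false))
  empty-stable {v} _ (in-empty , _) with trans (sym (lookup-replicate v false)) in-empty
  ... | ()

  best : Maximum (λ b → RA G (χ (lookup b))) (λ b → c · χ (lookup b))
  best with maximum? (n G) (λ b → RA? G (χ (lookup b))) (λ b → c · χ (lookup b))
  ... | inj₁ found = found
  ... | inj₂ none  = ⊥-elim (none (replicate (n G) false) (StableChar⇒RA G (χ-StableChar G empty-stable)))

  s : Fin (n G) → Bool
  s = lookup (proj₁ best)

  s-stable : IsStable G s
  s-stable = RA-χ⇒IsStable G (proj₁ (proj₂ best))

  s-max : ∀ y′ → RA G y′ → Binary y′ → c · y′ ≤ c · χ s
  s-max y′ y′∈RA y′-binary = begin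
    c · y′                ≡⟨ sumF-cong (λ v → cong (c v *_) (y′≗b′ v)) ⟩
    c · χ (lookup b′)     ≤⟨ proj₂ (proj₂ best) b′ (RA-cong G y′≗b′ y′∈RA) ⟩
    c · χ s               ∎
    where
    open ≤-Reasoning
    b′ = tabulate (λ u → isYes (y′ u ≟ 1ℚ))
    y′≗b′ : ∀ v → y′ v ≡ χ (lookup b′) v
    y′≗b′ v = trans (binary≡χ y′-binary v) (cong toℚ (sym (lookup∘tabulate _ v)))

module Perturbation {G : Graph} {x : Pt (n G)} (x∈RA : RA G x) {s : Fin (n G) → Bool} (s-stable : IsStable G s)
                    {ε : ℚ} (0≤ε : 0ℚ ≤ ε) (ε≤2/5 : ε ≤ 2/5) (ε≤headroom : ∀ v → ε ≤ headroom (integrality (x v))) where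
  bounds = proj₁ (proj₁ x∈RA)
  edges = proj₂ (proj₁ x∈RA)
  triangles = proj₂ x∈RA

  kind : ∀ v → Integrality (x v)
  kind v = integrality (x v)

  y : Fin (n G) → Bool
  y v = round (kind v) (s v)

  y-stable : IsStable G y
  y-stable {u} {w} uw (yu , yw) with round≡true (kind u) yu | round≡true (kind w) yw
  ... | _ , inj₁ xu≡1     | xw≢0 , _         = xw≢0 (RA-1-neighbour G x∈RA uw xu≡1)
  ... | xu≢0 , inj₂ _     | _ , inj₁ xw≡1    = xu≢0 (RA-1-neighbour G x∈RA (Adj-sym G uw) xw≡1)
  ... | _ , inj₂ su       | _ , inj₂ sw      = s-stable uw (su , sw)

  y-agrees : ∀ v → (x v ≡ 0ℚ → χ y v ≡ 0ℚ) × (x v ≡ 1ℚ → χ y v ≡ 1ℚ)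
  y-agrees v = cong toℚ ∘ proj₁ (round-agrees (kind v) (s v)) , cong toℚ ∘ proj₂ (round-agrees (kind v) (s v))

  open Nudge 0≤ε (≤-trans ε≤2/5 decide-≤)

  xε : Pt (n G)
  xε v = nudge (kind v) (s v) ε

  s-neighbour : ∀ {u w} → Adj G u w → s u ≡ true → s w ≡ false
  s-neighbour {u} {w} uw su with s w in sw
  ... | false = refl
  ... | true  = ⊥-elim (s-stable uw (su , sw))

  xε≤x : ∀ v → s v ≡ false → xε v ≤ x v
  xε≤x v sv≡false rewrite sv≡false = nudge-false-≤ (kind v)

  xε-room : ∀ v → s v ≡ false → xε v + ε ≤ 1ℚ
  xε-room v sv≡false rewrite sv≡false = nudge-false-room (kind v) (ε≤headroom v)

  xε≤x-or-raised : ∀ v → xε v ≤ x v ⊎ (s v ≡ true × xε v ≡ ε)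
  xε≤x-or-raised v = nudge-≤-or-raised (kind v) (s v)

  xε-edge : ∀ u w → Adj G u w → xε u + xε w ≤ 1ℚ
  xε-edge u w uw with xε≤x-or-raised u | xε≤x-or-raised w
  ... | inj₂ (su , xεu≡ε) | _ =
    subst (_≤ 1ℚ) (trans (+-comm (xε w) ε) (cong (_+ xε w) (sym xεu≡ε))) (xε-room w (s-neighbour uw su))
  ... | inj₁ _ | inj₂ (sw , xεw≡ε) =
    subst (_≤ 1ℚ) (cong (xε u +_) (sym xεw≡ε)) (xε-room u (s-neighbour (Adj-sym G uw) sw))
  ... | inj₁ xεu≤xu | inj₁ xεw≤xw = ≤-trans (+-mono-≤ xεu≤xu xεw≤xw) (edges u w uw)

  -- The raised vertex contributes ε ≤ 2/5, the other two at most x v + x w ≤ 1.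
  xε-triangle-raised : ∀ u v w → Adj G u v → Adj G v w → Adj G u w → s u ≡ true → xε u ≡ ε →
    xε u + xε v + xε w ≤ 7/5
  xε-triangle-raised u v w uv vw uw su xεu≡ε = begin
    xε u + xε v + xε w      ≡⟨ +-assoc (xε u) (xε v) (xε w) ⟩
    xε u + (xε v + xε w)    ≤⟨ +-mono-≤ (≤-trans (≤-reflexive xεu≡ε) ε≤2/5)
                                  (≤-trans (+-mono-≤ (xε≤x v (s-neighbour uv su)) (xε≤x w (s-neighbour uw su)))
                                           (edges v w vw)) ⟩
    2/5 + 1ℚ                ≡⟨⟩
    7/5                     ∎
    where open ≤-Reasoning

  xε-triangle : ∀ u v w → Adj G u v → Adj G v w → Adj G u w → xε u + xε v + xε w ≤ 7/5
  xε-triangle u v w uv vw uw with xε≤x-or-raised u | xε≤x-or-raised v | xε≤x-or-raised w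
  ... | inj₂ (su , xεu≡ε) | _ | _ = xε-triangle-raised u v w uv vw uw su xεu≡ε
  ... | inj₁ _ | inj₂ (sv , xεv≡ε) | _ = subst (_≤ 7/5) (+-CS.xy∙z≈zx∙y (xε v) (xε w) (xε u))
    (xε-triangle-raised v w u vw (Adj-sym G uw) (Adj-sym G uv) sv xεv≡ε)
  ... | inj₁ _ | inj₁ _ | inj₂ (sw , xεw≡ε) = subst (_≤ 7/5) (+-CS.xy∙z≈yz∙x (xε w) (xε u) (xε v))
    (xε-triangle-raised w u v (Adj-sym G uw) uv (Adj-sym G vw) sw xεw≡ε)
  ... | inj₁ xεu≤xu | inj₁ xεv≤xv | inj₁ xεw≤xw =
    ≤-trans (+-mono-≤ (+-mono-≤ xεu≤xu xεv≤xv) xεw≤xw) (triangles u v w uv vw uw)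

  xε∈RA : RA G xε
  xε∈RA = ((λ v → nudge-bounds (kind v) (s v) (proj₁ (bounds v)) (proj₂ (bounds v))) , xε-edge) , xε-triangle

  objective : ∀ c → c · xε + ε * (c · χ y) ≡ c · x + ε * (c · χ s)
  objective c = begin
    c · xε + ε * (c · χ y)                          ≡⟨ cong (c · xε +_) (sumF-*ˡ ε (λ v → c v * χ y v)) ⟨
    c · xε + sumF (λ v → ε * (c v * χ y v))         ≡⟨ sumF-+ (λ v → c v * xε v) (λ v → ε * (c v * χ y v)) ⟨
    sumF (λ v → c v * xε v + ε * (c v * χ y v))     ≡⟨ sumF-cong (λ v → trans (factor (c v) (xε v) ε (χ y v))
                                                         (trans (cong (c v *_) (nudge-linear (kind v) (s v) ε))
                                                                (sym (factor (c v) (x v) ε (χ s v))))) ⟩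
    sumF (λ v → c v * x v + ε * (c v * χ s v))      ≡⟨ sumF-+ (λ v → c v * x v) (λ v → ε * (c v * χ s v)) ⟩
    c · x + sumF (λ v → ε * (c v * χ s v))          ≡⟨ cong (c · x +_) (sumF-*ˡ ε (λ v → c v * χ s v)) ⟩
    c · x + ε * (c · χ s)                           ∎
    where
    open ≡-Reasoning
    factor : ∀ a p e t → a * p + e * (a * t) ≡ a * (p + e * t)
    factor = solve 4 (λ a p e t → a :* p :+ e :* (a :* t) := a :* (p :+ e :* t)) refl

≤-fromPerturbation : ∀ {ε p p′ A B} → 0ℚ < ε → p′ ≤ p → p′ + ε * B ≡ p + ε * A → A ≤ B
≤-fromPerturbation {ε} {p} {p′} {A} {B} 0<ε p′≤p p′+εB≡p+εA =
  *-cancelˡ-≤-pos ε {{positive 0<ε}} (+-cancelˡ-≤ p (begin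
    p + ε * A     ≡⟨ p′+εB≡p+εA ⟨
    p′ + ε * B    ≤⟨ +-monoˡ-≤ (ε * B) p′≤p ⟩
    p + ε * B     ∎))
  where open ≤-Reasoning

persistent : ∀ G → Persistent (RA G)
persistent G c x x∈RA x-max = χ y , StableChar⇒RA G (χ-StableChar G y-stable) , χ-binary y ,
  (λ y′ y′∈RA y′-binary → ≤-trans (s-max y′ y′∈RA y′-binary) s≤y) , y-agrees
  where
  open BestStableSet G c
  bound = positive-lowerBound 2/5 (λ v → headroom (integrality (x v))) decide-<
            (λ v → headroom-pos (integrality (x v)) (proj₂ (proj₁ (proj₁ x∈RA) v)))
  ε = proj₁ bound
  0<ε = proj₁ (proj₂ bound)
  open Perturbation x∈RA s-stable (<⇒≤ 0<ε) (proj₁ (proj₂ (proj₂ bound))) (proj₂ (proj₂ (proj₂ bound)))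
  s≤y : c · χ s ≤ c · χ y
  s≤y = ≤-fromPerturbation 0<ε (x-max xε xε∈RA) (objective c)

proposition4 : CondB RA × CondC RA × ¬ CondA RA × (∀ G → Persistent (RA G))
proposition4 = condB , condC , ¬condA , persistent
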